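{- On a set $X$ with at least 4 elements, no binary relation $R$ is both anti-transitive and such that its incomparability relation $R^8=\{(x,y):\lnot xRy\land\lnot yRx\}$ is left unique.
   Context: Write $xRy$ for $(x,y)\in R$. $R$ is anti-transitive if $xRy\land yRz\to\lnot xRz$ for all $x,y,z$. A relation $S$ is left unique if $x_1Sy\land x_2Sy\to x_1=x_2$ for all $x_1,x_2,y$. -}

module Defs where

open import Level using (Level; _⊔_)
open import Relation.Binary.Core using (Rel)
open import Relation.Binary.PropositionalEquality using (_≡_)
open import Relation.Nullary using (¬_)
open import Data.Product using (_×_; Σ-syntax)

AntiTransitive : ∀ {a ℓ} {X : Set a} → Rel X ℓ → Set (a ⊔ ℓ)
AntiTransitive {X = X} R = ∀ {x y z : X} → R x y → R y z → ¬ R x z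

LeftUnique : ∀ {a ℓ} {X : Set a} → Rel X ℓ → Set (a ⊔ ℓ)
LeftUnique {X = X} S = ∀ {x₁ x₂ y : X} → S x₁ y → S x₂ y → x₁ ≡ x₂

Incomparable : ∀ {a ℓ} {X : Set a} → Rel X ℓ → Rel X ℓ
Incomparable R x y = ¬ R x y × ¬ R y x

AtLeast4 : ∀ {a} → Set a → Set a
AtLeast4 X = Σ[ a ∈ X ] Σ[ b ∈ X ] Σ[ c ∈ X ] Σ[ d ∈ X ]
  (¬ a ≡ b × ¬ a ≡ c × ¬ a ≡ d × ¬ b ≡ c × ¬ b ≡ d × ¬ c ≡ d)

-- Anti-transitivity makes R irreflexive, so every y is incomparable to itself,
-- and left uniqueness of incomparability then forces distinct elements to be
-- comparable.  Two successors (or two predecessors) q ≠ r of one point would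
-- be comparable, and either orientation of the edge between them closes a
-- forbidden triangle; so each point has at most one successor and at most one
-- predecessor, hence at most two neighbours, while among four points each one
-- is comparable with three others.
module Submission where

open import Defs
open import Level using (Level)
open import Function using (flip)
open import Relation.Binary.Core using (Rel)
open import Relation.Binary.PropositionalEquality using (_≡_; _≢_)
open import Relation.Nullary using (¬_)
open import Data.Product using (_×_; _,_; swap)

flip-incomparable⇒≡ : ∀ {a ℓ} {X : Set a} {R : Rel X ℓ} →
                      (∀ {x y} → Incomparable R x y → x ≡ y) →
                      ∀ {x y} → Incomparable (flip R) x y → x ≡ y
flip-incomparable⇒≡ incomparable⇒≡ x#y = incomparable⇒≡ (swap x#y)

module _ {a ℓ} {X : Set a} {R : Rel X ℓ} (anti : AntiTransitive R) where

  antiTransitive⇒irreflexive : ∀ x → ¬ R x x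
  antiTransitive⇒irreflexive x rxx = anti rxx rxx rxx

  flip-antiTransitive : AntiTransitive (flip R)
  flip-antiTransitive ryx rzy = anti rzy ryx

  leftUnique⇒incomparable⇒≡ : LeftUnique (Incomparable R) →
                              ∀ {x y} → Incomparable R x y → x ≡ y
  leftUnique⇒incomparable⇒≡ unique {y = y} x#y =
    unique x#y (antiTransitive⇒irreflexive y , antiTransitive⇒irreflexive y)

  module _ (incomparable⇒≡ : ∀ {x y} → Incomparable R x y → x ≡ y) where

    successor-unique : ∀ {p q r} → R p q → R p r → q ≡ r
    successor-unique rpq rpr =
      incomparable⇒≡ ((λ rqr → anti rpq rqr rpr) , (λ rrq → anti rpr rrq rpq))

    predecessor-unique : ∀ {p q r} → R q p → R r p → q ≡ r
    predecessor-unique rqp rrp =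
      incomparable⇒≡ ((λ rqr → anti rqr rrp rqp) , (λ rrq → anti rrq rqp rrp))

    ≢⇒comparable : ∀ {x y} → x ≢ y → ¬ R x y → ¬ ¬ R y x
    ≢⇒comparable x≢y ¬rxy ¬ryx = x≢y (incomparable⇒≡ (¬rxy , ¬ryx))

    -- z and w cannot be successors of x besides y, so both are predecessors.
    ¬successorBesides : ∀ {x y z w} → x ≢ z → x ≢ w → y ≢ z → y ≢ w → z ≢ w →
                        ¬ R x y
    ¬successorBesides {x} {y} {z} {w} x≢z x≢w y≢z y≢w z≢w rxy =
      ≢⇒comparable x≢z ¬rxz λ rzx →
      ≢⇒comparable x≢w ¬rxw λ rwx →
      z≢w (predecessor-unique rzx rwx)
      where
      ¬rxz : ¬ R x z
      ¬rxz rxz = y≢z (successor-unique rxy rxz)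
      ¬rxw : ¬ R x w
      ¬rxw rxw = y≢w (successor-unique rxy rxw)

mainTheorem14 : ∀ {a ℓ : Level} (X : Set a) → AtLeast4 X →
    (R : Rel X ℓ) → ¬ (AntiTransitive R × LeftUnique (Incomparable R))
mainTheorem14 X (a , b , c , d , a≢b , a≢c , a≢d , b≢c , b≢d , c≢d) R (anti , unique) =
  -- The hypotheses are self-dual, so the case R b a is the case R a b for flip R.
  ≢⇒comparable anti incomparable⇒≡ a≢b
    (¬successorBesides anti incomparable⇒≡ a≢c a≢d b≢c b≢d c≢d)
    (¬successorBesides (flip-antiTransitive {R = R} anti)
      (flip-incomparable⇒≡ incomparable⇒≡) a≢c a≢d b≢c b≢d c≢d)
  where
  incomparable⇒≡ : ∀ {x y} → Incomparable R x y → x ≡ y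
  incomparable⇒≡ = leftUnique⇒incomparable⇒≡ anti unique
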